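{- For every $n\ge 6$, $\#\mathrm{Av}_n([1234],[1432])=0$.
   Context: For a linear permutation $\pi=\pi_1\ldots\pi_n$ of $[n]$, the cyclic permutation $[\pi]$ is the set of all rotations of $\pi$. A linear permutation $\sigma$ contains $\pi$ if some subsequence of $\sigma$ is order isomorphic to $\pi$ (same relative order). A cyclic permutation $[\sigma]$ contains $[\pi]$ if some rotation of $\sigma$ contains $\pi$; otherwise it avoids $[\pi]$. For a set of cyclic patterns $[\Pi]$, $\mathrm{Av}_n[\Pi]$ denotes the set of cyclic permutations of length $n$ avoiding every pattern in $[\Pi]$. -}

module Defs where

open import Data.Nat using (ℕ; zero; suc; _+_)
open import Data.Nat.DivMod using (_mod_)
open import Data.Fin using (Fin; zero; suc; toℕ; _<_)
open import Data.Fin.Permutation using (Permutation′; _⟨$⟩ʳ_)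
open import Data.Product using (Σ; _×_)
open import Function.Bundles using (_⇔_)
open import Relation.Nullary using (¬_)

Seq : ℕ → Set
Seq n = Fin n → Fin n

oneLine : ∀ {n} → Permutation′ n → Seq n
oneLine π i = π ⟨$⟩ʳ i

rotate : ∀ {n} → Seq n → Fin n → Seq n
rotate {suc m} σ r i = σ ((toℕ i + toℕ r) mod suc m)

Contains : ∀ {n k} → Seq n → Seq k → Set
Contains {n} {k} σ π =
  Σ (Fin k → Fin n) λ e →
    (∀ i j → i < j → e i < e j) ×
    (∀ i j → (π i < π j) ⇔ (σ (e i) < σ (e j)))

-- the cyclic permutation [σ] contains [π]: some rotation of σ contains π
CycContains : ∀ {n k} → Seq n → Seq k → Set
CycContains {n} σ π = Σ (Fin n) λ r → Contains (rotate σ r) π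

CycAvoids : ∀ {n k} → Seq n → Seq k → Set
CycAvoids σ π = ¬ CycContains σ π

p1234 : Seq 4
p1234 i = i

p1432 : Seq 4
p1432 zero = zero
p1432 (suc zero) = suc (suc (suc zero))
p1432 (suc (suc zero)) = suc (suc zero)
p1432 (suc (suc (suc zero))) = suc zero

-- membership of (the class of) σ in Av_n([1234],[1432]);
-- being a cyclic-avoidance property, it is invariant under rotation of σ
InAv : ∀ {n} → Permutation′ n → Set
InAv σ = CycAvoids (oneLine σ) p1234 × CycAvoids (oneLine σ) p1432

{-# OPTIONS --safe #-}
module Submission where

open import Defs
open import Data.Nat as ℕ using (ℕ; zero; suc; _+_; _∸_; _≥_; NonZero; s≤s; z<s; s<s)
open import Data.Nat.DivMod using (_%_; %-distribˡ-+; [m+n]%n≡m%n; m<n⇒m%n≡m)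
import Data.Nat.Properties as ℕ
open import Data.Fin as Fin using (Fin; zero; suc; toℕ; _<_; inject≤; #_)
open import Data.Fin.Properties
  using ( toℕ-injective; suc-injective; toℕ-fromℕ<; toℕ<n; toℕ-inject≤; inject≤-injective
        ; <-trans; <-cmp; <-irrefl; <-asym)
open import Data.Fin.Permutation using (Permutation′; _⟨$⟩ˡ_; inverseʳ)
open import Data.Product using (Σ-syntax; _×_; _,_)
open import Data.Sum using (_⊎_; inj₁; inj₂; swap; [_,_]′)
open import Level using (Level)
open import Function using (_∘_; flip)
open import Function.Bundles using (mk⇔; Injection)
open import Function.Definitions using (Injective)
open import Function.Properties.Inverse using (↔⇒↣)
open import Relation.Binary.Definitions using (tri<; tri≈; tri>)
open import Relation.Binary.PropositionalEquality
open import Relation.Nullary using (¬_; contradiction)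

-- Rotate [σ] so that its minimum comes first. Among any five distinct values there is a
-- monotone subsequence of length three (Erdős–Szekeres), so the five entries following the
-- minimum contain an increasing or a decreasing triple. Preceded by the minimum, an
-- increasing triple is a 1234 and a decreasing one a 1432.

private
  variable
    k n : ℕ

Increasing : (Fin k → Fin n) → Set
Increasing f = ∀ i j → i < j → f i < f j

increasing-Fin1 : (f : Fin 1 → Fin n) → Increasing f
increasing-Fin1 f zero zero ()

increasing-step : (f : Fin (suc (suc k)) → Fin n) →
                  f zero < f (suc zero) → Increasing (f ∘ Fin.suc) → Increasing f
increasing-step f f0<f1 inc zero    (suc zero)    _         = f0<f1
increasing-step f f0<f1 inc zero    (suc (suc j)) _         = <-trans f0<f1 (inc zero (suc j) z<s)
increasing-step f f0<f1 inc (suc i) (suc j)       (s<s i<j) = inc i j i<j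

increasing₄ : (f : Fin 4 → Fin n) → f zero < f (suc zero) →
              f (suc zero) < f (suc (suc zero)) → f (suc (suc zero)) < f (suc (suc (suc zero))) →
              Increasing f
increasing₄ f p q r =
  increasing-step f p (increasing-step (f ∘ Fin.suc) q (increasing-step (f ∘ Fin.suc ∘ Fin.suc) r
    (increasing-Fin1 (f ∘ Fin.suc ∘ Fin.suc ∘ Fin.suc))))

inject≤-increasing : .(k≤n : k ℕ.≤ n) → Increasing (λ (i : Fin k) → inject≤ i k≤n)
inject≤-increasing k≤n i j i<j = subst₂ ℕ._<_ (sym (toℕ-inject≤ i k≤n)) (sym (toℕ-inject≤ j k≤n)) i<j

unshift-mod : ∀ {x s} n .{{_ : NonZero n}} → x ℕ.< n → s ℕ.≤ n → (x + s + (n ∸ s)) % n ≡ x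
unshift-mod {x} {s} n x<n s≤n = begin
  (x + s + (n ∸ s)) % n   ≡⟨ cong (_% n) (ℕ.+-assoc x s (n ∸ s)) ⟩
  (x + (s + (n ∸ s))) % n ≡⟨ cong (λ t → (x + t) % n) (ℕ.m+[n∸m]≡n s≤n) ⟩
  (x + n) % n             ≡⟨ [m+n]%n≡m%n x n ⟩
  x % n                   ≡⟨ m<n⇒m%n≡m x<n ⟩
  x                       ∎
  where open ≡-Reasoning

+-mod-cancelʳ : ∀ {x y s} n .{{_ : NonZero n}} → x ℕ.< n → y ℕ.< n → s ℕ.≤ n →
                (x + s) % n ≡ (y + s) % n → x ≡ y
+-mod-cancelʳ {x} {y} {s} n x<n y<n s≤n eq = begin
  x                                     ≡⟨ unshift-mod n x<n s≤n ⟨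
  (x + s + (n ∸ s)) % n                 ≡⟨ %-distribˡ-+ (x + s) (n ∸ s) n ⟩
  ((x + s) % n + (n ∸ s) % n) % n       ≡⟨ cong (λ t → (t + (n ∸ s) % n) % n) eq ⟩
  ((y + s) % n + (n ∸ s) % n) % n       ≡⟨ %-distribˡ-+ (y + s) (n ∸ s) n ⟨
  (y + s + (n ∸ s)) % n                 ≡⟨ unshift-mod n y<n s≤n ⟩
  y                                     ∎
  where open ≡-Reasoning

rotate-injective : (τ : Seq n) (r : Fin n) → Injective _≡_ _≡_ τ → Injective _≡_ _≡_ (rotate τ r)
rotate-injective {suc m} τ r τ-inj {x} {y} eq =
  toℕ-injective (+-mod-cancelʳ (suc m) (toℕ<n x) (toℕ<n y) (ℕ.<⇒≤ (toℕ<n r))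
    (trans (sym (toℕ-fromℕ< _)) (trans (cong toℕ (τ-inj eq)) (toℕ-fromℕ< _))))

rotate-at-zero : (τ : Seq (suc n)) (r : Fin (suc n)) → rotate τ r zero ≡ τ r
rotate-at-zero τ r = cong τ (toℕ-injective (trans (toℕ-fromℕ< _) (m<n⇒m%n≡m (toℕ<n r))))

private
  f0 f1 f2 f3 f4 : Fin 5
  f0 = # 0
  f1 = # 1
  f2 = # 2
  f3 = # 3
  f4 = # 4

module _ {a ℓ : Level} {A : Set a} where

  IncreasingTriple : (A → A → Set ℓ) → (Fin k → A) → Set ℓ
  IncreasingTriple {k} _≺_ v = Σ[ i ∈ Fin k ] Σ[ j ∈ Fin k ] Σ[ l ∈ Fin k ]
    i < j × j < l × v i ≺ v j × v j ≺ v l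

  Comparable : (A → A → Set ℓ) → (Fin k → A) → Set ℓ
  Comparable _≺_ v = ∀ i j → i ≢ j → v i ≺ v j ⊎ v j ≺ v i

  comparable-flip : {_≺_ : A → A → Set ℓ} {v : Fin k → A} →
                    Comparable _≺_ v → Comparable (flip _≺_) v
  comparable-flip cmp i j i≢j = swap (cmp i j i≢j)

  erdősSzekeres₅-ascending : (_≺_ : A → A → Set ℓ) (v : Fin 5 → A) → Comparable _≺_ v →
                             v f0 ≺ v f1 → IncreasingTriple _≺_ v ⊎ IncreasingTriple (flip _≺_) v
  erdősSzekeres₅-ascending _≺_ v cmp v0≺v1 with cmp f1 f2 (λ ())
  ... | inj₁ v1≺v2 = inj₁ (f0 , f1 , f2 , z<s , s<s z<s , v0≺v1 , v1≺v2)
  ... | inj₂ v2≺v1 with cmp f0 f2 (λ ())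
  ... | inj₁ v0≺v2 with cmp f2 f3 (λ ())
  ...   | inj₁ v2≺v3 = inj₁ (f0 , f2 , f3 , z<s , s<s (s<s z<s) , v0≺v2 , v2≺v3)
  ...   | inj₂ v3≺v2 = inj₂ (f1 , f2 , f3 , s<s z<s , s<s (s<s z<s) , v2≺v1 , v3≺v2)
  erdősSzekeres₅-ascending _≺_ v cmp v0≺v1 | inj₂ v2≺v1 | inj₂ v2≺v0 with cmp f1 f3 (λ ())
  ... | inj₁ v1≺v3 = inj₁ (f0 , f1 , f3 , z<s , s<s z<s , v0≺v1 , v1≺v3)
  ... | inj₂ v3≺v1 with cmp f2 f3 (λ ())
  ...   | inj₂ v3≺v2 = inj₂ (f0 , f2 , f3 , z<s , s<s (s<s z<s) , v2≺v0 , v3≺v2)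
  ...   | inj₁ v2≺v3 with cmp f1 f4 (λ ())
  ...     | inj₁ v1≺v4 = inj₁ (f0 , f1 , f4 , z<s , s<s z<s , v0≺v1 , v1≺v4)
  ...     | inj₂ v4≺v1 with cmp f3 f4 (λ ())
  ...       | inj₁ v3≺v4 = inj₁ (f2 , f3 , f4 , s<s (s<s z<s) , s<s (s<s (s<s z<s)) , v2≺v3 , v3≺v4)
  ...       | inj₂ v4≺v3 = inj₂ (f1 , f3 , f4 , s<s z<s , s<s (s<s (s<s z<s)) , v3≺v1 , v4≺v3)

  erdősSzekeres₅ : (_≺_ : A → A → Set ℓ) (v : Fin 5 → A) → Comparable _≺_ v →
                   IncreasingTriple _≺_ v ⊎ IncreasingTriple (flip _≺_) v
  erdősSzekeres₅ _≺_ v cmp with cmp f0 f1 (λ ())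
  ... | inj₁ v0≺v1 = erdősSzekeres₅-ascending _≺_ v cmp v0≺v1
  ... | inj₂ v1≺v0 =
    swap (erdősSzekeres₅-ascending (flip _≺_) v (comparable-flip {_≺_ = _≺_} cmp) v1≺v0)

injective⇒comparable : (f : Fin k → Fin n) → Injective _≡_ _≡_ f → Comparable _<_ f
injective⇒comparable f f-inj i j i≢j with <-cmp (f i) (f j)
... | tri< fi<fj _ _ = inj₁ fi<fj
... | tri≈ _ fi≡fj _ = contradiction (f-inj fi≡fj) i≢j
... | tri> _ _ fj<fi = inj₂ fj<fi

-- For an involution π the order isomorphism τ ∘ e ≅ π amounts to τ ∘ e ∘ π being increasing.
contains-involution : (τ : Seq n) (π : Seq k) → (∀ i → π (π i) ≡ i) →
                      (e : Fin k → Fin n) → Increasing e → Increasing (τ ∘ e ∘ π) → Contains τ π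
contains-involution τ π π-invol e e-inc τeπ-inc = e , e-inc , λ i j → mk⇔ (to i j) (from i j)
  where
  to : ∀ i j → π i < π j → τ (e i) < τ (e j)
  to i j πi<πj = subst₂ (λ x y → τ (e x) < τ (e y)) (π-invol i) (π-invol j) (τeπ-inc (π i) (π j) πi<πj)
  from : ∀ i j → τ (e i) < τ (e j) → π i < π j
  from i j τei<τej with <-cmp (π i) (π j)
  ... | tri< πi<πj _ _ = πi<πj
  ... | tri≈ _ πi≡πj _ =
    contradiction (cong (τ ∘ e) (trans (sym (π-invol i)) (trans (cong π πi≡πj) (π-invol j))))
                  (λ eq → <-irrefl eq τei<τej)
  ... | tri> _ _ πj<πi = contradiction (to j i πj<πi) (<-asym τei<τej)

p1432-involutive : ∀ i → p1432 (p1432 i) ≡ i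
p1432-involutive zero                   = refl
p1432-involutive (suc zero)             = refl
p1432-involutive (suc (suc zero))       = refl
p1432-involutive (suc (suc (suc zero))) = refl

behindZero : Fin n → Fin n → Fin n → Fin 4 → Fin (suc n)
behindZero i j l zero                   = zero
behindZero i j l (suc zero)             = suc i
behindZero i j l (suc (suc zero))       = suc j
behindZero i j l (suc (suc (suc _)))    = suc l

module _ (τ : Seq (suc n)) (τ0≡0 : τ zero ≡ zero) (τ-inj : Injective _≡_ _≡_ τ)
         {i j l : Fin n} (i<j : i < j) (j<l : j < l) where

  private
    τ0<τ[1+_] : ∀ x → τ zero < τ (suc x)
    τ0<τ[1+ x ] rewrite τ0≡0 with τ (suc x) in eq
    ... | suc _ = z<s
    ... | zero  = contradiction (τ-inj (trans eq (sym τ0≡0))) λ ()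

    positions-increasing : Increasing (behindZero i j l)
    positions-increasing = increasing₄ (behindZero i j l) z<s (s<s i<j) (s<s j<l)

  contains1234-behindZero : τ (suc i) < τ (suc j) → τ (suc j) < τ (suc l) → Contains τ p1234
  contains1234-behindZero τi<τj τj<τl =
    contains-involution τ p1234 (λ _ → refl) (behindZero i j l) positions-increasing
      (increasing₄ (τ ∘ behindZero i j l) (τ0<τ[1+ i ]) τi<τj τj<τl)

  contains1432-behindZero : τ (suc j) < τ (suc i) → τ (suc l) < τ (suc j) → Contains τ p1432
  contains1432-behindZero τj<τi τl<τj =
    contains-involution τ p1432 p1432-involutive (behindZero i j l) positions-increasing
      (increasing₄ (τ ∘ behindZero i j l ∘ p1432) (τ0<τ[1+ l ]) τl<τj τj<τi)

contains1234⊎contains1432 : ∀ {m} (τ : Seq (suc m)) → 5 ℕ.≤ m → τ zero ≡ zero →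
                            Injective _≡_ _≡_ τ → Contains τ p1234 ⊎ Contains τ p1432
contains1234⊎contains1432 {m} τ m≥5 τ0≡0 τ-inj
  with erdősSzekeres₅ _<_ (τ ∘ Fin.suc ∘ inj) (injective⇒comparable _ τ∘suc∘inj-injective)
  where
  inj : Fin 5 → Fin m
  inj t = inject≤ t m≥5
  τ∘suc∘inj-injective : Injective _≡_ _≡_ (τ ∘ Fin.suc ∘ inj)
  τ∘suc∘inj-injective = inject≤-injective m≥5 m≥5 _ _ ∘ suc-injective ∘ τ-inj
... | inj₁ (i , j , l , i<j , j<l , up₁ , up₂) =
  inj₁ (contains1234-behindZero τ τ0≡0 τ-inj
         (inject≤-increasing m≥5 i j i<j) (inject≤-increasing m≥5 j l j<l) up₁ up₂)
... | inj₂ (i , j , l , i<j , j<l , down₁ , down₂) =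
  inj₂ (contains1432-behindZero τ τ0≡0 τ-inj
         (inject≤-increasing m≥5 i j i<j) (inject≤-increasing m≥5 j l j<l) down₁ down₂)

mainTheorem5 : (n : ℕ) → n ≥ 6 → (σ : Permutation′ n) → ¬ InAv σ
mainTheorem5 (suc m) (s≤s m≥5) σ (avoids1234 , avoids1432) =
  [ avoids1234 ∘ (r ,_) , avoids1432 ∘ (r ,_) ]′ (contains1234⊎contains1432 τ m≥5 τ0≡0 τ-injective)
  where
  r : Fin (suc m)
  r = σ ⟨$⟩ˡ zero
  τ : Seq (suc m)
  τ = rotate (oneLine σ) r
  τ0≡0 : τ zero ≡ zero
  τ0≡0 = trans (rotate-at-zero (oneLine σ) r) (inverseʳ σ)
  τ-injective : Injective _≡_ _≡_ τ
  τ-injective = rotate-injective (oneLine σ) r (Injection.injective (↔⇒↣ σ))
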